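{- Let $(\mathcal K,r_n)$ be a pre-extender, and let the partitions $\mathscr P_k,\mathscr P_k'$ and groups $G_k$ ($k\ge0$) be constructed as follows: $\mathscr P_0=\{\text{set of all flags of }\mathcal K\}$; given $\mathscr P_k$, let $G_k=\{\tau\in\Gamma(\mathcal K):\Phi\sim_{\mathscr P_k}\Phi\tau \text{ for all flags }\Phi\}$, let $\mathscr P_k'=\{\Phi G_k:\Phi\text{ a flag of }\mathcal K\}$, and let $\mathscr P_{k+1}$ be the partition in which $\Phi\sim_{\mathscr P_{k+1}}\Psi$ if and only if $\Phi\sim_{\mathscr P_k'}\Psi$ and $r_n\Phi\sim_{\mathscr P_k'}r_n\Psi$. Then $\heartsuit(\mathcal K,r_n)=\bigcap_{k=0}^\infty G_k$.
   Context: An $n$-premaniplex is a graph (semi-edges and parallel edges allowed) whose vertices, called flags, carry a proper edge colouring with colours $0,\dots,n-1$, each flag $\Phi$ having exactly one incident dart of each colour $i$, with other end $r_i\Phi$; one requires $r_ir_jr_ir_j=1$ for $|i-j|>1$. An $n$-maniplex is a connected $n$-premaniplex in which $r_i$ and $r_ir_j$ ($i\ne j$) have no fixed points. Automorphisms are colour-preserving and act on the right; $\Gamma(\mathcal K)$ is the automorphism group. For a partition $\mathscr P$ of the flags, $\Phi\sim_{\mathscr P}\Psi$ means $\Phi,\Psi$ lie in the same part. A pre-extender $(\mathcal K,r_n)$ is an $n$-maniplex $\mathcal K$ with a permutation $r_n$ of its flags, $r_n^2=1$, commuting with $r_0,\dots,r_{n-2}$. A subset $S\subseteq\Gamma(\mathcal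 K)$ is $r_n$-friendly if for every flag $\Phi$ and every $\tau\in S$ there is $\bar\tau\in S$ with $r_n(\Phi\tau)=(r_n\Phi)\bar\tau$. $\heartsuit(\mathcal K,r_n)$ denotes the union of all $r_n$-friendly subsets of $\Gamma(\mathcal K)$ (the greatest $r_n$-friendly set, a subgroup of $\Gamma(\mathcal K)$). -}

module Defs where

open import Data.Nat using (ℕ; zero; suc; _<_; _≤_)
open import Data.Fin using (Fin; toℕ)
open import Data.Product using (Σ; _×_; _,_; ∃)
open import Data.Sum using (_⊎_)
open import Data.Unit using (⊤)
open import Relation.Binary.PropositionalEquality using (_≡_; _≢_)

-- Flags are elements of a type Flag; colour i dart of Φ goes to r i Φ.

data Reach {Flag : Set} {n : ℕ} (r : Fin n → Flag → Flag) : Flag → Flag → Set where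
  here : ∀ {Φ} → Reach r Φ Φ
  step : ∀ {Φ Ψ} (i : Fin n) → Reach r (r i Φ) Ψ → Reach r Φ Ψ

record IsManiplex (n : ℕ) (Flag : Set) (r : Fin n → Flag → Flag) : Set where
  field
    invol     : ∀ i Φ → r i (r i Φ) ≡ Φ
    commuting : ∀ (i j : Fin n) → (suc (suc (toℕ i)) ≤ toℕ j ⊎ suc (suc (toℕ j)) ≤ toℕ i) →
                ∀ Φ → r i (r j (r i (r j Φ))) ≡ Φ
    noFix₁    : ∀ i Φ → r i Φ ≢ Φ
    noFix₂    : ∀ i j → i ≢ j → ∀ Φ → r i (r j Φ) ≢ Φ
    connected : ∀ Φ Ψ → Reach r Φ Ψ

-- Automorphisms: colour-preserving bijections of flags, acting on the right;
-- Φ · τ is written act τ Φ.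
record Aut {n : ℕ} (Flag : Set) (r : Fin n → Flag → Flag) : Set where
  field
    act     : Flag → Flag
    inv     : Flag → Flag
    act-inv : ∀ Φ → act (inv Φ) ≡ Φ
    inv-act : ∀ Φ → inv (act Φ) ≡ Φ
    colour  : ∀ i Φ → act (r i Φ) ≡ r i (act Φ)
open Aut public

record IsPreExtender (n : ℕ) (Flag : Set) (r : Fin n → Flag → Flag) (rn : Flag → Flag) : Set where
  field
    maniplex : IsManiplex n Flag r
    rn-invol : ∀ Φ → rn (rn Φ) ≡ Φ
    rn-comm  : ∀ (i : Fin n) → suc (toℕ i) < n → ∀ Φ → rn (r i Φ) ≡ r i (rn Φ)

module _ {n : ℕ} {Flag : Set} (r : Fin n → Flag → Flag) (rn : Flag → Flag) where

  Friendly : (Aut Flag r → Set) → Set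
  Friendly S = ∀ (Φ : Flag) (τ : Aut Flag r) → S τ →
    Σ (Aut Flag r) λ τ̄ → S τ̄ × (rn (act τ Φ) ≡ act τ̄ (rn Φ))

  Heart : Aut Flag r → Set₁
  Heart τ = Σ (Aut Flag r → Set) λ S → Friendly S × S τ

  -- The partitions P_k (as equivalence relations), groups G_k and partitions P'_k.
  mutual
    P : ℕ → Flag → Flag → Set
    P zero    Φ Ψ = ⊤
    P (suc k) Φ Ψ = P′ k Φ Ψ × P′ k (rn Φ) (rn Ψ)

    G : ℕ → Aut Flag r → Set
    G k τ = ∀ Φ → P k Φ (act τ Φ)

    P′ : ℕ → Flag → Flag → Set
    P′ k Φ Ψ = Σ (Aut Flag r) λ τ → G k τ × (Ψ ≡ act τ Φ)

{-# OPTIONS --safe #-}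
-- Every r_n-friendly set S lies in each G_k: by induction on k, for τ ∈ S the
-- friendliness witness τ̄ ∈ S ⊆ G_k shows r_n Φ ~ r_n (Φ τ) in P'_k.
-- Conversely ⋂ G_k is itself friendly: membership in G_1 yields, for each flag Φ,
-- some τ̄ with r_n (Φ τ) = (r_n Φ) τ̄, and since automorphisms of a connected
-- maniplex are determined by the image of one flag, the witnesses coming from
-- every G_(k+1) coincide with τ̄, which therefore lies in every G_k.
module Submission where

open import Defs
open import Data.Nat using (ℕ; zero; suc)
open import Data.Fin using (Fin)
open import Data.Product using (_,_; proj₂)
open import Data.Unit using (tt)
open import Function.Bundles using (_⇔_; mk⇔)
open import Relation.Binary.PropositionalEquality using (_≡_; refl; sym; trans; cong; subst)

module _ {n : ℕ} {Flag : Set} {r : Fin n → Flag → Flag} where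

  act-agree-along-Reach : (σ σ′ : Aut Flag r) → ∀ {Φ Ψ} →
    act σ Φ ≡ act σ′ Φ → Reach r Φ Ψ → act σ Ψ ≡ act σ′ Ψ
  act-agree-along-Reach σ σ′ eq here = eq
  act-agree-along-Reach σ σ′ {Φ} eq (step i path) =
    act-agree-along-Reach σ σ′ (trans (colour σ i Φ) (trans (cong (r i) eq) (sym (colour σ′ i Φ)))) path

  module _ (rn : Flag → Flag) where

    G-resp-≗ : ∀ k (σ σ′ : Aut Flag r) → (∀ Φ → act σ Φ ≡ act σ′ Φ) → G r rn k σ → G r rn k σ′
    G-resp-≗ k σ σ′ eq σ∈G Φ = subst (P r rn k Φ) (eq Φ) (σ∈G Φ)

    Friendly⇒⊆G : (S : Aut Flag r → Set) → Friendly r rn S → ∀ k σ → S σ → G r rn k σ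
    Friendly⇒⊆G S friendly zero    σ σ∈S Φ = tt
    Friendly⇒⊆G S friendly (suc k) σ σ∈S Φ with friendly Φ σ σ∈S
    ... | σ̄ , σ̄∈S , eq =
      (σ , Friendly⇒⊆G S friendly k σ σ∈S , refl) , (σ̄ , Friendly⇒⊆G S friendly k σ̄ σ̄∈S , eq)

    ⋂G : Aut Flag r → Set
    ⋂G σ = ∀ k → G r rn k σ

    ⋂G-Friendly : (∀ Φ Ψ → Reach r Φ Ψ) → Friendly r rn ⋂G
    ⋂G-Friendly connected Φ σ σ∈⋂G with proj₂ (σ∈⋂G 1 Φ)
    ... | σ̄ , _ , eq = σ̄ , σ̄∈⋂G , eq
      where
      σ̄∈⋂G : ⋂G σ̄
      σ̄∈⋂G k with proj₂ (σ∈⋂G (suc k) Φ)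
      ... | σₖ , σₖ∈G , eqₖ =
        G-resp-≗ k σₖ σ̄ (λ Ψ → act-agree-along-Reach σₖ σ̄ (trans (sym eqₖ) eq) (connected (rn Φ) Ψ)) σₖ∈G

proposition5p15 : (n : ℕ) (Flag : Set) (r : Fin n → Flag → Flag) (rn : Flag → Flag) →
    IsPreExtender n Flag r rn →
    ∀ (τ : Aut Flag r) → Heart r rn τ ⇔ (∀ (k : ℕ) → G r rn k τ)
proposition5p15 n Flag r rn preExtender τ = mk⇔
  (λ { (S , friendly , τ∈S) k → Friendly⇒⊆G rn S friendly k τ τ∈S })
  (λ τ∈⋂G → ⋂G rn , ⋂G-Friendly rn connected , τ∈⋂G)
  where
  connected : ∀ Φ Ψ → Reach r Φ Ψ
  connected = IsManiplex.connected (IsPreExtender.maniplex preExtender)
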